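{- Let $q\ge 2$ and let $M$ be the star matrix of a partition of ${\bf Z}_q^n$ into subcubes all of the same dimension. Then in every column of $M$, each value of ${\bf Z}_q$ occurs the same number of times.
   Context: A subcube of ${\bf Z}_q^n$ is a set obtained by fixing some coordinates to given elements of ${\bf Z}_q$ and letting the others run over all of ${\bf Z}_q$; its dimension is the number of free coordinates. Its star pattern is the vector in $({\bf Z}_q\cup\{*\})^n$ whose $i$th entry is the fixed value of coordinate $i$ if fixed and $*$ otherwise. The star matrix of a partition of ${\bf Z}_q^n$ into subcubes is the matrix whose rows are the star patterns of the subcubes of the partition. -}

module Defs where

open import Data.Nat using (ℕ)
open import Data.Fin using (Fin)
open import Data.Fin.Properties using (_≟_)
open import Data.Maybe using (Maybe; just; nothing)
open import Data.List using (List; length; filter; allFin)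
open import Data.Product using (_×_; Σ)
open import Data.Sum using (_⊎_)
open import Relation.Binary.PropositionalEquality using (_≡_)
open import Relation.Nullary using (Dec; yes; no)

-- A star pattern in (Z_q ∪ {*})^n : nothing plays the role of *,
-- just a means the coordinate is fixed to a ∈ Z_q (= Fin q).
StarPattern : ℕ → ℕ → Set
StarPattern q n = Fin n → Maybe (Fin q)

Point : ℕ → ℕ → Set
Point q n = Fin n → Fin q

_∈cube_ : ∀ {q n} → Point q n → StarPattern q n → Set
x ∈cube p = ∀ i → (p i ≡ nothing) ⊎ (p i ≡ just (x i))

dim : ∀ {q n} → StarPattern q n → ℕ
dim {n = n} p = length (filter (λ i → isStar (p i)) (allFin n))
  where
  isStar : (m : Maybe _) → Dec (m ≡ nothing)
  isStar nothing  = yes _≡_.refl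
  isStar (just _) = no (λ ())

StarMatrix : ℕ → ℕ → ℕ → Set
StarMatrix m q n = Fin m → StarPattern q n

IsPartition : ∀ {m q n} → StarMatrix m q n → Set
IsPartition {m} {q} {n} M =
  ∀ (x : Point q n) → Σ (Fin m) λ k → (x ∈cube M k) × (∀ k' → x ∈cube M k' → k' ≡ k)

countInColumn : ∀ {m q n} → StarMatrix m q n → Fin n → Fin q → ℕ
countInColumn {m} M i a = length (filter (λ k → eqJ (M k i)) (allFin m))
  where
  eqJ : (v : Maybe _) → Dec (v ≡ just a)
  eqJ nothing = no (λ ())
  eqJ (just b) with b ≟ a
  ... | yes _≡_.refl = yes _≡_.refl
  ... | no b≢a = no (λ { _≡_.refl → b≢a _≡_.refl })

{-# OPTIONS --safe #-}
module Submission where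

-- Double counting. Fix a column i and count the points x with x i = a. Counted directly, this
-- number does not depend on a. Counted subcube by subcube, a subcube with a star in column i
-- contributes an amount independent of a, while a subcube whose entry there is c contributes
-- its full size q ^ d if c = a and nothing otherwise. Hence (number of rows with entry a in
-- column i) * q ^ d does not depend on a.

open import Defs
open import Data.Nat using (ℕ; NonZero; _≥_; zero; suc; _+_; _*_; _^_; s≤s; z≤n; >-nonZero)
open import Data.Nat.Properties
  using (+-*-semiring; *-commutativeSemigroup; +-identityʳ; *-identityˡ; *-identityʳ; *-zeroʳ;
         +-comm; +-cancelˡ-≡; *-cancelʳ-≡; ^-distribˡ-+-*; m^n≢0; ≤-trans)
open import Data.Fin using (Fin; zero; suc; punchIn)
open import Data.Fin.Properties using (_≟_; all?; ∀-cons-⇔; punchInᵢ≢i)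
open import Data.Maybe using (Maybe; just; nothing)
open import Data.Maybe.Properties using () renaming (≡-dec to ≡-decₘ)
open import Data.Bool using (true; false; if_then_else_)
open import Data.List using (length; filter; tabulate; allFin)
open import Data.Vec.Functional using (_∷_; head; tail)
open import Data.Product using (_,_)
open import Data.Sum using (_⊎_; inj₁; inj₂)
open import Level using (Level)
open import Function using (_⇔_)
open import Relation.Unary using (Pred; Decidable)
open import Relation.Nullary using (Dec; yes; no; does; ¬_; _×-dec_; _⊎-dec_)
open import Relation.Nullary.Decidable using (dec-true; dec-false; does-≡; does-⇔)
open import Relation.Binary.Definitions using (DecidableEquality)
open import Relation.Binary.PropositionalEquality
  using (_≡_; refl; sym; trans; cong; cong₂; module ≡-Reasoning)
open import Algebra.Properties.Semiring.Sum +-*-semiring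
  using (sum-syntax; sum-cong-≗; sum-remove; sum-replicate-zero; ∑-comm; ∑-distrib-+;
         *-distribˡ-sum; *-distribʳ-sum)
open import Algebra.Properties.CommutativeSemigroup *-commutativeSemigroup using (x∙yz≈y∙xz)

open ≡-Reasoning

private
  variable
    a b p : Level
    A : Set a
    B : Set b

𝟙 : Dec A → ℕ
𝟙 a? = if does a? then 1 else 0

𝟙-yes : (a? : Dec A) → A → 𝟙 a? ≡ 1
𝟙-yes a? x = cong (if_then 1 else 0) (dec-true a? x)

𝟙-no : (a? : Dec A) → ¬ A → 𝟙 a? ≡ 0
𝟙-no a? ¬x = cong (if_then 1 else 0) (dec-false a? ¬x)

𝟙-⇔ : A ⇔ B → (a? : Dec A) (b? : Dec B) → 𝟙 a? ≡ 𝟙 b?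
𝟙-⇔ A⇔B a? b? = cong (if_then 1 else 0) (does-⇔ A⇔B a? b?)

𝟙-×-dec : (a? : Dec A) (b? : Dec B) → 𝟙 (a? ×-dec b?) ≡ 𝟙 a? * 𝟙 b?
𝟙-×-dec (yes _) b? = sym (+-identityʳ (𝟙 b?))
𝟙-×-dec (no _)  b? = refl

*-𝟙-cong : ∀ {m n} (a? : Dec A) → (A → m ≡ n) → m * 𝟙 a? ≡ n * 𝟙 a?
*-𝟙-cong                 (yes x) m≡n = cong (_* 1) (m≡n x)
*-𝟙-cong {m = m} {n = n} (no _)  _   = trans (*-zeroʳ m) (sym (*-zeroʳ n))

∑-1 : ∀ n → ∑[ i < n ] 1 ≡ n
∑-1 zero    = refl
∑-1 (suc n) = cong suc (∑-1 n)

∑-𝟙-unique : ∀ {m} {P : Pred (Fin m) p} (P? : Decidable P) {i} →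
             P i → (∀ j → P j → j ≡ i) → ∑[ j < m ] 𝟙 (P? j) ≡ 1
∑-𝟙-unique {m = suc m} P? {i} Pi unique = begin
  ∑[ j < suc m ] 𝟙 (P? j)                     ≡⟨ sum-remove {i = i} (λ j → 𝟙 (P? j)) ⟩
  𝟙 (P? i) + ∑[ j < m ] 𝟙 (P? (punchIn i j))  ≡⟨ cong₂ _+_ (𝟙-yes (P? i) Pi) (sum-cong-≗ vanish) ⟩
  1 + ∑[ j < m ] 0                            ≡⟨ cong (1 +_) (sum-replicate-zero m) ⟩
  1                                           ∎
  where
  vanish : ∀ j → 𝟙 (P? (punchIn i j)) ≡ 0
  vanish j = 𝟙-no (P? (punchIn i j)) (λ P[j] → punchInᵢ≢i i j (unique _ P[j]))

length-filter-tabulate : ∀ {m} {P : Pred A p} (P? : Decidable P) (f : Fin m → A) →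
                         length (filter P? (tabulate f)) ≡ ∑[ k < m ] 𝟙 (P? (f k))
length-filter-tabulate {m = zero}  P? f = refl
length-filter-tabulate {m = suc m} P? f with does (P? (f zero))
... | true  = cong suc (length-filter-tabulate P? (λ k → f (suc k)))
... | false = length-filter-tabulate P? (λ k → f (suc k))

length-filter-allFin : ∀ {m} {P : Pred (Fin m) p} (P? Q? : Decidable P) →
                       length (filter P? (allFin m)) ≡ ∑[ k < m ] 𝟙 (Q? k)
length-filter-allFin P? Q? = trans (length-filter-tabulate P? (λ k → k))
  (sum-cong-≗ (λ k → cong (if_then 1 else 0) (does-≡ (P? k) (Q? k))))

_≟ₘ_ : ∀ {q} → DecidableEquality (Maybe (Fin q))
_≟ₘ_ = ≡-decₘ _≟_

module _ {q : ℕ} where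

  sumPoints : ∀ n → (Point q n → ℕ) → ℕ
  sumPoints zero    f = f (λ ())
  sumPoints (suc n) f = ∑[ v < q ] sumPoints n (λ x → f (v ∷ x))

  sumPoints-cong : ∀ n {f g : Point q n → ℕ} → (∀ x → f x ≡ g x) → sumPoints n f ≡ sumPoints n g
  sumPoints-cong zero    f≗g = f≗g _
  sumPoints-cong (suc n) f≗g = sum-cong-≗ (λ v → sumPoints-cong n (λ x → f≗g (v ∷ x)))

  *-distribˡ-sumPoints : ∀ n c (f : Point q n → ℕ) → sumPoints n (λ x → c * f x) ≡ c * sumPoints n f
  *-distribˡ-sumPoints zero    c f = refl
  *-distribˡ-sumPoints (suc n) c f =
    trans (sum-cong-≗ (λ v → *-distribˡ-sumPoints n c (λ x → f (v ∷ x))))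
          (sym (*-distribˡ-sum c (λ v → sumPoints n (λ x → f (v ∷ x)))))

  sumPoints-∑-comm : ∀ n {m} (g : Fin m → Point q n → ℕ) →
                     sumPoints n (λ x → ∑[ k < m ] g k x) ≡ ∑[ k < m ] sumPoints n (g k)
  sumPoints-∑-comm zero    g = refl
  sumPoints-∑-comm (suc n) g =
    trans (sum-cong-≗ (λ v → sumPoints-∑-comm n (λ k x → g k (v ∷ x))))
          (∑-comm (λ v k → sumPoints n (λ x → g k (v ∷ x))))

  fits? : (r : Maybe (Fin q)) (v : Fin q) → Dec ((r ≡ nothing) ⊎ (r ≡ just v))
  fits? r v = (r ≟ₘ nothing) ⊎-dec (r ≟ₘ just v)

  _∈cube?_ : ∀ {n} (x : Point q n) (p : StarPattern q n) → Dec (x ∈cube p)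
  x ∈cube? p = all? (λ i → fits? (p i) (x i))

  ∈cube-fixed : ∀ {n} {x : Point q n} {p : StarPattern q n} {c} i →
                x ∈cube p → p i ≡ just c → x i ≡ c
  ∈cube-fixed {p = p} i x∈p p[i]≡c with p i | x∈p i | p[i]≡c
  ... | just _  | inj₂ refl | refl = refl

  𝟙-∈cube-∷ : ∀ {n} (p : StarPattern q (suc n)) v (x : Point q n) →
              𝟙 ((v ∷ x) ∈cube? p) ≡ 𝟙 (fits? (head p) v) * 𝟙 (x ∈cube? tail p)
  𝟙-∈cube-∷ p v x =
    trans (sym (𝟙-⇔ ∀-cons-⇔ (fits? (head p) v ×-dec x ∈cube? tail p) ((v ∷ x) ∈cube? p)))
          (𝟙-×-dec (fits? (head p) v) (x ∈cube? tail p))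

  cubeSize : ∀ {n} → StarPattern q n → ℕ
  cubeSize {n} p = sumPoints n (λ x → 𝟙 (x ∈cube? p))

  ∑-𝟙-fits? : ∀ r → ∑[ v < q ] 𝟙 (fits? r v) ≡ q ^ 𝟙 (r ≟ₘ nothing)
  ∑-𝟙-fits? nothing  = trans (∑-1 q) (sym (*-identityʳ q))
  ∑-𝟙-fits? (just c) = ∑-𝟙-unique (c ≟_) refl (λ _ → sym)

  cubeSize≡q^stars : ∀ {n} (p : StarPattern q n) → cubeSize p ≡ q ^ ∑[ j < n ] 𝟙 (p j ≟ₘ nothing)
  cubeSize≡q^stars {zero}  p = 𝟙-yes ((λ ()) ∈cube? p) (λ ())
  cubeSize≡q^stars {suc n} p = begin
    ∑[ v < q ] sumPoints n (λ x → 𝟙 ((v ∷ x) ∈cube? p))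
      ≡⟨ sum-cong-≗ (λ v → sumPoints-cong n (𝟙-∈cube-∷ p v)) ⟩
    ∑[ v < q ] sumPoints n (λ x → 𝟙 (fits? (head p) v) * 𝟙 (x ∈cube? tail p))
      ≡⟨ sum-cong-≗ (λ v → *-distribˡ-sumPoints n (𝟙 (fits? (head p) v)) _) ⟩
    ∑[ v < q ] (𝟙 (fits? (head p) v) * cubeSize (tail p))
      ≡⟨ sym (*-distribʳ-sum (cubeSize (tail p)) (λ v → 𝟙 (fits? (head p) v))) ⟩
    (∑[ v < q ] 𝟙 (fits? (head p) v)) * cubeSize (tail p)
      ≡⟨ cong₂ _*_ (∑-𝟙-fits? (head p)) (cubeSize≡q^stars (tail p)) ⟩
    q ^ 𝟙 (head p ≟ₘ nothing) * q ^ ∑[ j < n ] 𝟙 (p (suc j) ≟ₘ nothing)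
      ≡⟨ sym (^-distribˡ-+-* q (𝟙 (head p ≟ₘ nothing)) (∑[ j < n ] 𝟙 (p (suc j) ≟ₘ nothing))) ⟩
    q ^ ∑[ j < suc n ] 𝟙 (p j ≟ₘ nothing) ∎

  cubeSize≡q^dim : ∀ {n} (p : StarPattern q n) → cubeSize p ≡ q ^ dim p
  cubeSize≡q^dim p =
    trans (cubeSize≡q^stars p) (cong (q ^_) (sym (length-filter-allFin _ (λ j → p j ≟ₘ nothing))))

  sliceSize : ∀ {n} → StarPattern q n → Fin n → Fin q → ℕ
  sliceSize {n} p i a = sumPoints n (λ x → 𝟙 (x i ≟ a) * 𝟙 (x ∈cube? p))

  sliceSize-zero : ∀ {n} (p : StarPattern q (suc n)) → head p ≡ nothing → ∀ a →
                   sliceSize p zero a ≡ cubeSize (tail p)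
  sliceSize-zero {n} p p₀≡* a = begin
    ∑[ v < q ] sumPoints n (λ x → 𝟙 (v ≟ a) * 𝟙 ((v ∷ x) ∈cube? p))
      ≡⟨ sum-cong-≗ (λ v → sumPoints-cong n (λ x → cong (𝟙 (v ≟ a) *_) (drop-head v x))) ⟩
    ∑[ v < q ] sumPoints n (λ x → 𝟙 (v ≟ a) * 𝟙 (x ∈cube? tail p))
      ≡⟨ sum-cong-≗ (λ v → *-distribˡ-sumPoints n (𝟙 (v ≟ a)) (λ x → 𝟙 (x ∈cube? tail p))) ⟩
    ∑[ v < q ] (𝟙 (v ≟ a) * cubeSize (tail p))
      ≡⟨ sym (*-distribʳ-sum (cubeSize (tail p)) (λ v → 𝟙 (v ≟ a))) ⟩
    (∑[ v < q ] 𝟙 (v ≟ a)) * cubeSize (tail p)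
      ≡⟨ cong (_* cubeSize (tail p)) (∑-𝟙-unique (_≟ a) refl (λ _ v≡a → v≡a)) ⟩
    1 * cubeSize (tail p)
      ≡⟨ *-identityˡ (cubeSize (tail p)) ⟩
    cubeSize (tail p) ∎
    where
    drop-head : ∀ v x → 𝟙 ((v ∷ x) ∈cube? p) ≡ 𝟙 (x ∈cube? tail p)
    drop-head v x = begin
      𝟙 ((v ∷ x) ∈cube? p)                         ≡⟨ 𝟙-∈cube-∷ p v x ⟩
      𝟙 (fits? (head p) v) * 𝟙 (x ∈cube? tail p)  ≡⟨ cong (_* _) (𝟙-yes (fits? (head p) v) (inj₁ p₀≡*)) ⟩
      1 * 𝟙 (x ∈cube? tail p)                      ≡⟨ *-identityˡ _ ⟩
      𝟙 (x ∈cube? tail p)                          ∎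

  sliceSize-suc : ∀ {n} (p : StarPattern q (suc n)) i a →
                  sliceSize p (suc i) a ≡ ∑[ v < q ] (𝟙 (fits? (head p) v) * sliceSize (tail p) i a)
  sliceSize-suc {n} p i a = sum-cong-≗ λ v → begin
    sumPoints n (λ x → 𝟙 (x i ≟ a) * 𝟙 ((v ∷ x) ∈cube? p))
      ≡⟨ sumPoints-cong n (λ x → cong (𝟙 (x i ≟ a) *_) (𝟙-∈cube-∷ p v x)) ⟩
    sumPoints n (λ x → 𝟙 (x i ≟ a) * (𝟙 (fits? (head p) v) * 𝟙 (x ∈cube? tail p)))
      ≡⟨ sumPoints-cong n (λ x → x∙yz≈y∙xz (𝟙 (x i ≟ a)) (𝟙 (fits? (head p) v)) _) ⟩
    sumPoints n (λ x → 𝟙 (fits? (head p) v) * (𝟙 (x i ≟ a) * 𝟙 (x ∈cube? tail p)))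
      ≡⟨ *-distribˡ-sumPoints n (𝟙 (fits? (head p) v)) (λ x → 𝟙 (x i ≟ a) * 𝟙 (x ∈cube? tail p)) ⟩
    𝟙 (fits? (head p) v) * sliceSize (tail p) i a ∎

  sliceSize-star : ∀ {n} (p : StarPattern q n) i → p i ≡ nothing → ∀ a b →
                   sliceSize p i a ≡ sliceSize p i b
  sliceSize-star p zero    p₀≡* a b =
    trans (sliceSize-zero p p₀≡* a) (sym (sliceSize-zero p p₀≡* b))
  sliceSize-star p (suc i) p[i]≡* a b = begin
    sliceSize p (suc i) a
      ≡⟨ sliceSize-suc p i a ⟩
    ∑[ v < q ] (𝟙 (fits? (head p) v) * sliceSize (tail p) i a)
      ≡⟨ sum-cong-≗ (λ v → cong (𝟙 (fits? (head p) v) *_) IH) ⟩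
    ∑[ v < q ] (𝟙 (fits? (head p) v) * sliceSize (tail p) i b)
      ≡⟨ sliceSize-suc p i b ⟨
    sliceSize p (suc i) b ∎
    where
    IH : sliceSize (tail p) i a ≡ sliceSize (tail p) i b
    IH = sliceSize-star (tail p) i p[i]≡* a b

  sliceSize-fixed : ∀ {n} (p : StarPattern q n) i {c} → p i ≡ just c → ∀ a →
                    sliceSize p i a ≡ 𝟙 (c ≟ a) * cubeSize p
  sliceSize-fixed {n} p i {c} p[i]≡c a =
    trans (sumPoints-cong n only-c) (*-distribˡ-sumPoints n (𝟙 (c ≟ a)) (λ x → 𝟙 (x ∈cube? p)))
    where
    only-c : ∀ x → 𝟙 (x i ≟ a) * 𝟙 (x ∈cube? p) ≡ 𝟙 (c ≟ a) * 𝟙 (x ∈cube? p)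
    only-c x = *-𝟙-cong (x ∈cube? p) (λ x∈p → cong (λ y → 𝟙 (y ≟ a)) (∈cube-fixed i x∈p p[i]≡c))

  sliceSize-balance : ∀ {n} (p : StarPattern q n) i a b →
    sliceSize p i a + 𝟙 (p i ≟ₘ just b) * cubeSize p ≡
    sliceSize p i b + 𝟙 (p i ≟ₘ just a) * cubeSize p
  sliceSize-balance p i a b with p i in p[i]≡r
  ... | nothing = cong (_+ 0) (sliceSize-star p i p[i]≡r a b)
  ... | just c  = begin
    sliceSize p i a + 𝟙 (c ≟ b) * cubeSize p         ≡⟨ cong (_+ _) (sliceSize-fixed p i p[i]≡r a) ⟩
    𝟙 (c ≟ a) * cubeSize p + 𝟙 (c ≟ b) * cubeSize p  ≡⟨ +-comm (𝟙 (c ≟ a) * cubeSize p) _ ⟩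
    𝟙 (c ≟ b) * cubeSize p + 𝟙 (c ≟ a) * cubeSize p  ≡⟨ cong (_+ _) (sliceSize-fixed p i p[i]≡r b) ⟨
    sliceSize p i b + 𝟙 (c ≟ a) * cubeSize p         ∎

  hyperplaneSize : ∀ n → Fin n → Fin q → ℕ
  hyperplaneSize n i a = sumPoints n (λ x → 𝟙 (x i ≟ a))

  hyperplaneSize≡sliceSize-whole : ∀ {n} i a → hyperplaneSize n i a ≡ sliceSize (λ _ → nothing) i a
  hyperplaneSize≡sliceSize-whole {n} i a = sumPoints-cong n (λ x → sym (lies-in-whole x))
    where
    lies-in-whole : ∀ x → 𝟙 (x i ≟ a) * 𝟙 (x ∈cube? (λ _ → nothing)) ≡ 𝟙 (x i ≟ a)
    lies-in-whole x =
      trans (cong (𝟙 (x i ≟ a) *_) (𝟙-yes (x ∈cube? (λ _ → nothing)) (λ _ → inj₁ refl)))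
            (*-identityʳ (𝟙 (x i ≟ a)))

  hyperplaneSize-independent : ∀ {n} i a b → hyperplaneSize n i a ≡ hyperplaneSize n i b
  hyperplaneSize-independent i a b = begin
    hyperplaneSize _ i a           ≡⟨ hyperplaneSize≡sliceSize-whole i a ⟩
    sliceSize (λ _ → nothing) i a  ≡⟨ sliceSize-star (λ _ → nothing) i refl a b ⟩
    sliceSize (λ _ → nothing) i b  ≡⟨ hyperplaneSize≡sliceSize-whole i b ⟨
    hyperplaneSize _ i b           ∎

  module _ {m n} {M : StarMatrix m q n} (partition : IsPartition M) where

    ∑-𝟙-∈cube : ∀ x → ∑[ k < m ] 𝟙 (x ∈cube? M k) ≡ 1
    ∑-𝟙-∈cube x with partition x
    ... | _ , x∈M[k] , unique = ∑-𝟙-unique (λ k → x ∈cube? M k) x∈M[k] unique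

    hyperplaneSize≡∑sliceSize : ∀ i a → hyperplaneSize n i a ≡ ∑[ k < m ] sliceSize (M k) i a
    hyperplaneSize≡∑sliceSize i a = begin
      hyperplaneSize n i a
        ≡⟨ sumPoints-cong n spread ⟩
      sumPoints n (λ x → ∑[ k < m ] (𝟙 (x i ≟ a) * 𝟙 (x ∈cube? M k)))
        ≡⟨ sumPoints-∑-comm n (λ k x → 𝟙 (x i ≟ a) * 𝟙 (x ∈cube? M k)) ⟩
      ∑[ k < m ] sliceSize (M k) i a ∎
      where
      spread : ∀ x → 𝟙 (x i ≟ a) ≡ ∑[ k < m ] (𝟙 (x i ≟ a) * 𝟙 (x ∈cube? M k))
      spread x = begin
        𝟙 (x i ≟ a)                                  ≡⟨ *-identityʳ (𝟙 (x i ≟ a)) ⟨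
        𝟙 (x i ≟ a) * 1                              ≡⟨ cong (𝟙 (x i ≟ a) *_) (∑-𝟙-∈cube x) ⟨
        𝟙 (x i ≟ a) * ∑[ k < m ] 𝟙 (x ∈cube? M k)
          ≡⟨ *-distribˡ-sum (𝟙 (x i ≟ a)) (λ k → 𝟙 (x ∈cube? M k)) ⟩
        ∑[ k < m ] (𝟙 (x i ≟ a) * 𝟙 (x ∈cube? M k))  ∎

    column-balance : ∀ {s} → (∀ k → cubeSize (M k) ≡ s) → ∀ i a b →
                     (∑[ k < m ] 𝟙 (M k i ≟ₘ just a)) * s ≡ (∑[ k < m ] 𝟙 (M k i ≟ₘ just b)) * s
    column-balance {s} size≡s i a b = +-cancelˡ-≡ (hyperplaneSize n i a) _ _ (begin
      hyperplaneSize n i a + count a * s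
        ≡⟨ cong (_+ count a * s) (hyperplaneSize-independent i a b) ⟩
      hyperplaneSize n i b + count a * s
        ≡⟨ split b a ⟩
      ∑[ k < m ] (sliceSize (M k) i b + 𝟙 (M k i ≟ₘ just a) * cubeSize (M k))
        ≡⟨ sum-cong-≗ (λ k → sliceSize-balance (M k) i a b) ⟨
      ∑[ k < m ] (sliceSize (M k) i a + 𝟙 (M k i ≟ₘ just b) * cubeSize (M k))
        ≡⟨ split a b ⟨
      hyperplaneSize n i a + count b * s ∎)
      where
      count : Fin q → ℕ
      count c = ∑[ k < m ] 𝟙 (M k i ≟ₘ just c)

      split : ∀ c c′ → hyperplaneSize n i c + count c′ * s ≡
              ∑[ k < m ] (sliceSize (M k) i c + 𝟙 (M k i ≟ₘ just c′) * cubeSize (M k))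
      split c c′ = begin
        hyperplaneSize n i c + count c′ * s
          ≡⟨ cong₂ _+_ (hyperplaneSize≡∑sliceSize i c)
                       (*-distribʳ-sum s (λ k → 𝟙 (M k i ≟ₘ just c′))) ⟩
        ∑[ k < m ] sliceSize (M k) i c + ∑[ k < m ] (𝟙 (M k i ≟ₘ just c′) * s)
          ≡⟨ ∑-distrib-+ (λ k → sliceSize (M k) i c) (λ k → 𝟙 (M k i ≟ₘ just c′) * s) ⟨
        ∑[ k < m ] (sliceSize (M k) i c + 𝟙 (M k i ≟ₘ just c′) * s)
          ≡⟨ sum-cong-≗ (λ k → cong (λ t → _ + 𝟙 (M k i ≟ₘ just c′) * t) (size≡s k)) ⟨
        ∑[ k < m ] (sliceSize (M k) i c + 𝟙 (M k i ≟ₘ just c′) * cubeSize (M k)) ∎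

lemma2 : (q n m : ℕ) → q ≥ 2 → (M : StarMatrix m q n) → IsPartition M →
    (d : ℕ) → (∀ k → dim (M k) ≡ d) →
    ∀ (i : Fin n) (a b : Fin q) → countInColumn M i a ≡ countInColumn M i b
lemma2 q n m q≥2 M partition d dim≡d i a b = begin
  countInColumn M i a
    ≡⟨ length-filter-allFin _ (λ k → M k i ≟ₘ just a) ⟩
  ∑[ k < m ] 𝟙 (M k i ≟ₘ just a)
    ≡⟨ *-cancelʳ-≡ _ _ (q ^ d) {{q^d≢0}} (column-balance partition cubeSize≡q^d i a b) ⟩
  ∑[ k < m ] 𝟙 (M k i ≟ₘ just b)
    ≡⟨ length-filter-allFin _ (λ k → M k i ≟ₘ just b) ⟨
  countInColumn M i b ∎
  where
  q^d≢0 : NonZero (q ^ d)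
  q^d≢0 = m^n≢0 q d {{>-nonZero (≤-trans (s≤s z≤n) q≥2)}}

  cubeSize≡q^d : ∀ k → cubeSize (M k) ≡ q ^ d
  cubeSize≡q^d k = trans (cubeSize≡q^dim (M k)) (cong (q ^_) (dim≡d k))
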